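{- Let $n\ge 9$ be an integer, let $C_n: v_1v_2\ldots v_nv_1$ be the cycle of order $n$, and let $G=C_n\bar{C}_n$ be its complementary prism, with vertex set $\{v_1,\ldots,v_n\}\cup\{\bar v_1,\ldots,\bar v_n\}$. Indices are taken modulo $n$. Let $C\subseteq\{v_1,\ldots,v_n\}$ and $\bar{C}\subseteq\{\bar v_1,\ldots,\bar v_n\}$, and let $(x_1,\ldots,x_n)\in\{0,1\}^n$ with $x_i=1$ iff $v_i\in C$, and $(\bar x_1,\ldots,\bar x_n)\in\{0,1\}^n$ with $\bar x_i=1$ iff $\bar v_i\in\bar C$. Consider the following conditions, for all $i,j\in\{1,\ldots,n\}$ with $(j-i)\bmod n\notin\{0,2\}$: $C(i)$: $x_{i-1}+x_i+\bar x_i+x_{i+1}\ge 1$; $C(i,i+1)$: $x_{i-1}+\bar x_i+\bar x_{i+1}+x_{i+2}\ge 1$; $C(i,i+2)$: $x_{i-1}+x_i+\bar x_i+x_{i+2}+\bar x_{i+2}+x_{i+3}\ge 1$; $\bar C(i,j)$: $\bar x_{i-1}+x_i+\bar x_{i+1}+\bar x_{j-1}+x_j+\bar x_{j+1}\ge 1$; $\bar C(i,i+2)$: $\bar x_{i-1}+x_i+x_{i+2}+\bar x_{i+3}\ge 1$. If $C\cup\bar C$ is an identifying code in $G$, then all these conditions hold. Furthermore, if $|\bar C|\ge 4$, then $C\cup\bar C$ is an identifying code in $G$ if and only if all these conditions hold.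
   Context: The complementary prism $H\bar{H}$ of a graph $H$ with vertices $v_1,\ldots,v_n$ is the disjoint union of $H$ and its complement $\bar H$ (on vertices $\bar v_1,\ldots,\bar v_n$, where $\bar v_i\bar v_j$ is an edge iff $v_iv_j$ is not an edge of $H$) together with the perfect matching $v_1\bar v_1,\ldots,v_n\bar v_n$. A set $D$ of vertices of a graph $G$ is an identifying code if the sets $N_G[u]\cap D$ (where $N_G[u]$ is the closed neighborhood of $u$) are non-empty and pairwise distinct over all vertices $u$ of $G$. -}

module Defs where

open import Data.Nat using (ℕ; zero; suc; _+_; _∸_; _≤_; NonZero)
open import Data.Nat.DivMod using (_mod_)
open import Data.Fin using (Fin; toℕ)
open import Data.Fin.Subset using (Subset; _∈_; ∣_∣)
open import Data.Bool using (Bool; true; false; if_then_else_)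
open import Data.Vec using (lookup)
open import Data.Sum using (_⊎_; inj₁; inj₂)
open import Data.Product using (_×_; ∃)
open import Data.Empty using (⊥)
open import Relation.Nullary using (¬_)
open import Relation.Binary.PropositionalEquality using (_≡_; _≢_)
open import Function.Bundles using (_⇔_)

module _ (n : ℕ) .{{_ : NonZero n}} where

  -- index arithmetic modulo n (indices 0..n-1 stand for v_1..v_n)
  _⊕_ : Fin n → ℕ → Fin n
  i ⊕ k = (toℕ i + k) mod n

  _⊖_ : Fin n → ℕ → Fin n
  i ⊖ k = (toℕ i + (n ∸ k)) mod n

  CycAdj : Fin n → Fin n → Set
  CycAdj i j = (j ≡ i ⊕ 1) ⊎ (i ≡ j ⊕ 1)

  -- vertices of the complementary prism: inj₁ i = v_i, inj₂ i = v̄_i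
  Vertex : Set
  Vertex = Fin n ⊎ Fin n

  Adj : Vertex → Vertex → Set
  Adj (inj₁ i) (inj₁ j) = CycAdj i j
  Adj (inj₂ i) (inj₂ j) = (i ≢ j) × ¬ CycAdj i j
  Adj (inj₁ i) (inj₂ j) = i ≡ j
  Adj (inj₂ i) (inj₁ j) = i ≡ j

  N[_]∋_ : Vertex → Vertex → Set
  N[ u ]∋ w = (u ≡ w) ⊎ Adj u w

  InCode : Subset n → Subset n → Vertex → Set
  InCode C Cb (inj₁ i) = i ∈ C
  InCode C Cb (inj₂ i) = i ∈ Cb

  IsIdentifyingCode : Subset n → Subset n → Set
  IsIdentifyingCode C Cb =
    (∀ u → ∃ λ w → InCode C Cb w × N[ u ]∋ w)
    × (∀ u v → u ≢ v →
         ¬ (∀ w → (InCode C Cb w × N[ u ]∋ w) ⇔ (InCode C Cb w × N[ v ]∋ w)))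

  x : Subset n → Fin n → ℕ
  x S i = if lookup S i then 1 else 0

  Conditions : Subset n → Subset n → Set
  Conditions C Cb =
    (∀ i → 1 ≤ x C (i ⊖ 1) + x C i + x Cb i + x C (i ⊕ 1))
    × (∀ i → 1 ≤ x C (i ⊖ 1) + x Cb i + x Cb (i ⊕ 1) + x C (i ⊕ 2))
    × (∀ i → 1 ≤ x C (i ⊖ 1) + x C i + x Cb i + x C (i ⊕ 2) + x Cb (i ⊕ 2) + x C (i ⊕ 3))
    × (∀ i j → j ≢ i → j ≢ i ⊕ 2 →
         1 ≤ x Cb (i ⊖ 1) + x C i + x Cb (i ⊕ 1) + x Cb (j ⊖ 1) + x C j + x Cb (j ⊕ 1))
    × (∀ i → 1 ≤ x Cb (i ⊖ 1) + x C i + x C (i ⊕ 2) + x Cb (i ⊕ 3))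

-- A set D is an identifying code iff it dominates every vertex and meets N[u] △ N[u′]
-- for every pair u ≠ u′. In C_n C̄_n the vertices summed in C(i), C(i,i+1), C(i,i+2),
-- C̄(i,i+2) are exactly N[v_i] and the symmetric differences for the pairs (v_i,v_{i+1}),
-- (v_i,v_{i+2}), (v̄_i,v̄_{i+2}); those summed in C̄(i,j) contain N[v̄_i] △ N[v̄_j], with
-- equality unless j = i ± 2. This gives necessity, and sufficiency for these pairs.
-- Two vertices v_i, v_j at cyclic distance at least 3 have disjoint closed
-- neighbourhoods, so the code vertex of N[v_i] given by C(i) separates them. Finally, if
-- |C̄| ≥ 4 then C̄ contains some v̄_k with k ∉ {j - 1, j + 1, i}; it dominates v̄_j and
-- separates v̄_j from v_i. The argument only needs n ≥ 5.
module Submission where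

open import Defs
open import Data.Nat using (ℕ; _≤_; NonZero)
open import Data.Fin.Subset using (Subset; ∣_∣)
open import Data.Product using (_×_)
open import Function.Bundles using (_⇔_)

open import Data.Bool using (true; false)
open import Data.Empty using (⊥-elim)
open import Data.Fin using (Fin; toℕ; _≟_)
open import Data.Fin.Properties using (toℕ-fromℕ<; toℕ-injective; toℕ<n; any?)
open import Data.Fin.Subset using (_∈_; _∉_; _⊆_; _∪_; ⁅_⁆; ⋃; inside; outside)
open import Data.Fin.Subset.Properties
  using (_∈?_; p⊆q⇒∣p∣≤∣q∣; ∣⊥∣≡0; ∣⁅x⁆∣≡1; x∈⁅x⁆; x∈p∪q⁺; ∣p∣≤∣x∷p∣)
open import Data.List using (List; []; _∷_; foldl; map; length)
open import Data.List.Membership.Propositional using (lose) renaming (_∈_ to _∈ₗ_)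
open import Data.List.Relation.Unary.All as All using (All; []; _∷_)
open import Data.List.Relation.Unary.All.Properties using (++⁺)
open import Data.List.Relation.Unary.Any as Any using (Any; here; there)
open import Data.Nat as ℕ using (zero; suc; _+_; _∸_; _<_; _%_; z≤n; s≤s)
open import Data.Nat.DivMod using (%-distribˡ-+; m%n%n≡m%n; [m+n]%n≡m%n; m<n⇒m%n≡m)
open import Data.Nat.Properties as ℕ using ()
open import Data.Product as Product using (∃; _,_; proj₂; uncurry)
open import Data.Sum as Sum using (_⊎_; inj₁; inj₂; [_,_]; swap)
open import Data.Sum.Properties using (inj₁-injective; inj₂-injective; ≡-dec)
open import Data.Vec using ([]; _∷_; lookup)
open import Data.Vec.Properties using ([]=⇒lookup; lookup⇒[]=)
open import Function using (_∘_; flip; case_of_)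
open import Function.Bundles using (Equivalence; mk⇔)
import Function.Properties.Equivalence as ⇔
open import Relation.Nullary using (¬_; Dec; yes; no)
open import Relation.Nullary.Decidable using (_⊎-dec_; _×-dec_; ¬?; decidable-stable)
open import Relation.Binary.PropositionalEquality
  using (_≡_; _≢_; refl; sym; trans; cong; subst; module ≡-Reasoning)

open Equivalence using (to; from)

module Separation {V : Set} (_∈N[_] : V → V → Set) where

  Distinguishes : V → V → V → Set
  Distinguishes w u u′ = (w ∈N[ u ] × ¬ w ∈N[ u′ ]) ⊎ (w ∈N[ u′ ] × ¬ w ∈N[ u ])

  Distinguishes-sym : ∀ {w u u′} → Distinguishes w u u′ → Distinguishes w u′ u
  Distinguishes-sym = swap

  distinguishers-within : ∀ {u u′ S} →
    (∀ {w} → w ∈N[ u ] → w ∈N[ u′ ] ⊎ w ∈ₗ S) →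
    (∀ {w} → w ∈N[ u′ ] → w ∈N[ u ] ⊎ w ∈ₗ S) →
    ∀ {w} → Distinguishes w u u′ → w ∈ₗ S
  distinguishers-within cover cover′ (inj₁ (w∈ , w∉)) = Sum.fromInj₂ (⊥-elim ∘ w∉) (cover w∈)
  distinguishers-within cover cover′ (inj₂ (w∈ , w∉)) = Sum.fromInj₂ (⊥-elim ∘ w∉) (cover′ w∈)

  module _ (D : V → Set) where

    Indistinguishable : V → V → Set
    Indistinguishable u u′ = ∀ w → (D w × w ∈N[ u ]) ⇔ (D w × w ∈N[ u′ ])

    Indistinguishable-sym : ∀ {u u′} → Indistinguishable u u′ → Indistinguishable u′ u
    Indistinguishable-sym h w = ⇔.sym (h w)

    distinguished : ∀ {w u u′} → D w → Distinguishes w u u′ → ¬ Indistinguishable u u′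
    distinguished d (inj₁ (w∈ , w∉)) h = w∉ (proj₂ (to (h _) (d , w∈)))
    distinguished d (inj₂ (w∈ , w∉)) h = w∉ (proj₂ (from (h _) (d , w∈)))

    indistinguishable : (∀ w u → Dec (w ∈N[ u ])) → ∀ {u u′} →
      (∀ w → D w → ¬ Distinguishes w u u′) → Indistinguishable u u′
    indistinguishable _∈N?_ {u} {u′} none w = mk⇔
      (λ (d , w∈) → d , decidable-stable (w ∈N? u′) (λ w∉ → none w d (inj₁ (w∈ , w∉))))
      (λ (d , w∈) → d , decidable-stable (w ∈N? u) (λ w∉ → none w d (inj₂ (w∈ , w∉))))

    distinguished-by-any : ∀ {u u′ S} →
      All (λ w → Distinguishes w u u′) S → Any D S → ¬ Indistinguishable u u′
    distinguished-by-any dists d∈S = uncurry (flip distinguished) (All.lookupAny dists d∈S)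

    some-distinguisher-in : (∀ w u → Dec (w ∈N[ u ])) → (∀ w → Dec (D w)) → ∀ {u u′ S} →
      (∀ {w} → Distinguishes w u u′ → w ∈ₗ S) → ¬ Indistinguishable u u′ → Any D S
    some-distinguisher-in _∈N?_ D? complete separated = decidable-stable (Any.any? D? _)
      λ none → separated (indistinguishable _∈N?_ λ w d dist → none (lose (complete dist) d))

    dominator-in : ∀ {u S} → (∀ {w} → w ∈N[ u ] → w ∈ₗ S) → (∃ λ w → D w × w ∈N[ u ]) → Any D S
    dominator-in complete (w , d , w∈) = lose (complete w∈) d

    dominated-by-any : ∀ {u S} → All (_∈N[ u ]) S → Any D S → ∃ λ w → D w × w ∈N[ u ]
    dominated-by-any nbrs d∈S = Any.lookup d∈S , Product.swap (All.lookupAny nbrs d∈S)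

1≤m+n⇒ : ∀ m {n} → 1 ≤ m + n → 1 ≤ m ⊎ 1 ≤ n
1≤m+n⇒ zero    = inj₂
1≤m+n⇒ (suc m) _ = inj₁ (s≤s z≤n)

1≤m+n⇐ : ∀ {m n} → 1 ≤ m ⊎ 1 ≤ n → 1 ≤ m + n
1≤m+n⇐ {m} {n} = [ (λ p → ℕ.≤-trans p (ℕ.m≤m+n m n)) , (λ p → ℕ.≤-trans p (ℕ.m≤n+m n m)) ]

1≤foldl-+⇔ : ∀ {A : Set} (f : A → ℕ) s as →
  1 ≤ foldl (λ t a → t + f a) s as ⇔ (1 ≤ s ⊎ Any (λ a → 1 ≤ f a) as)
1≤foldl-+⇔ f s [] = mk⇔ inj₁ [ (λ p → p) , (λ ()) ]
1≤foldl-+⇔ f s (a ∷ as) = mk⇔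
  (λ p → [ Sum.map₂ here ∘ 1≤m+n⇒ s , inj₂ ∘ there ] (to ih p))
  (λ { (inj₁ p)         → from ih (inj₁ (1≤m+n⇐ (inj₁ p)))
     ; (inj₂ (here p))  → from ih (inj₁ (1≤m+n⇐ (inj₂ p)))
     ; (inj₂ (there p)) → from ih (inj₂ p) })
  where ih = 1≤foldl-+⇔ f (s + f a) as

∣p∪q∣≤∣p∣+∣q∣ : ∀ {m} (p q : Subset m) → ∣ p ∪ q ∣ ≤ ∣ p ∣ + ∣ q ∣
∣p∪q∣≤∣p∣+∣q∣ []            []            = z≤n
∣p∪q∣≤∣p∣+∣q∣ (outside ∷ p) (outside ∷ q) = ∣p∪q∣≤∣p∣+∣q∣ p q
∣p∪q∣≤∣p∣+∣q∣ (outside ∷ p) (inside ∷ q)  =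
  subst (suc ∣ p ∪ q ∣ ≤_) (sym (ℕ.+-suc ∣ p ∣ ∣ q ∣)) (s≤s (∣p∪q∣≤∣p∣+∣q∣ p q))
∣p∪q∣≤∣p∣+∣q∣ (inside ∷ p)  (b ∷ q)       =
  s≤s (ℕ.≤-trans (∣p∪q∣≤∣p∣+∣q∣ p q) (ℕ.+-monoʳ-≤ ∣ p ∣ (∣p∣≤∣x∷p∣ b q)))

∣⋃⁅xs⁆∣≤length : ∀ {m} (xs : List (Fin m)) → ∣ ⋃ (map ⁅_⁆ xs) ∣ ≤ length xs
∣⋃⁅xs⁆∣≤length {m} []       = ℕ.≤-reflexive (∣⊥∣≡0 m)
∣⋃⁅xs⁆∣≤length (a ∷ xs) = ℕ.≤-trans (∣p∪q∣≤∣p∣+∣q∣ ⁅ a ⁆ _)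
  (ℕ.+-mono-≤ (ℕ.≤-reflexive (∣⁅x⁆∣≡1 a)) (∣⋃⁅xs⁆∣≤length xs))

∉⋃⁅xs⁆⇒ : ∀ {m k} (xs : List (Fin m)) → k ∉ ⋃ (map ⁅_⁆ xs) → All (k ≢_) xs
∉⋃⁅xs⁆⇒ []       _  = []
∉⋃⁅xs⁆⇒ (a ∷ xs) k∉ = (λ { refl → k∉ (x∈p∪q⁺ (inj₁ (x∈⁅x⁆ a))) }) ∷ ∉⋃⁅xs⁆⇒ xs (k∉ ∘ x∈p∪q⁺ ∘ inj₂)

∃-∈-∉ : ∀ {m} {p q : Subset m} → ∣ q ∣ < ∣ p ∣ → ∃ λ k → k ∈ p × k ∉ q
∃-∈-∉ {p = p} {q} ∣q∣<∣p∣ with any? (λ k → (k ∈? p) ×-dec ¬? (k ∈? q))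
... | yes witness = witness
... | no  none    = ⊥-elim (ℕ.<⇒≱ ∣q∣<∣p∣ (p⊆q⇒∣p∣≤∣q∣ p⊆q))
  where
    p⊆q : p ⊆ q
    p⊆q {k} k∈p with k ∈? q
    ... | yes k∈q = k∈q
    ... | no  k∉q = ⊥-elim (none (k , k∈p , k∉q))

∃-∈-avoiding : ∀ {m} {p : Subset m} (xs : List (Fin m)) → length xs < ∣ p ∣ →
  ∃ λ k → k ∈ p × All (k ≢_) xs
∃-∈-avoiding xs len<∣p∣ with ∃-∈-∉ (ℕ.≤-<-trans (∣⋃⁅xs⁆∣≤length xs) len<∣p∣)
... | k , k∈p , k∉ = k , k∈p , ∉⋃⁅xs⁆⇒ xs k∉

module Cycle (n : ℕ) .{{_ : NonZero n}} where

  infixl 6 _⊞_ _⊟_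

  _⊞_ : Fin n → ℕ → Fin n
  _⊞_ = _⊕_ n

  _⊟_ : Fin n → ℕ → Fin n
  _⊟_ = _⊖_ n

  1≤n : 1 ≤ n
  1≤n = ℕ.>-nonZero⁻¹ n

  toℕ-⊞ : ∀ i k → toℕ (i ⊞ k) ≡ (toℕ i + k) % n
  toℕ-⊞ i k = toℕ-fromℕ< _

  [m%n+k]%n≡[m+k]%n : ∀ m k → (m % n + k) % n ≡ (m + k) % n
  [m%n+k]%n≡[m+k]%n m k = begin
    (m % n + k) % n          ≡⟨ %-distribˡ-+ (m % n) k n ⟩
    (m % n % n + k % n) % n  ≡⟨ cong (λ r → (r + k % n) % n) (m%n%n≡m%n m n) ⟩
    (m % n + k % n) % n      ≡⟨ %-distribˡ-+ m k n ⟨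
    (m + k) % n              ∎
    where open ≡-Reasoning

  ⊞-assoc : ∀ i a b → i ⊞ a ⊞ b ≡ i ⊞ (a + b)
  ⊞-assoc i a b = toℕ-injective (begin
    toℕ (i ⊞ a ⊞ b)          ≡⟨ toℕ-⊞ (i ⊞ a) b ⟩
    (toℕ (i ⊞ a) + b) % n    ≡⟨ cong (λ r → (r + b) % n) (toℕ-⊞ i a) ⟩
    ((toℕ i + a) % n + b) % n ≡⟨ [m%n+k]%n≡[m+k]%n (toℕ i + a) b ⟩
    (toℕ i + a + b) % n      ≡⟨ cong (_% n) (ℕ.+-assoc (toℕ i) a b) ⟩
    (toℕ i + (a + b)) % n    ≡⟨ toℕ-⊞ i (a + b) ⟨
    toℕ (i ⊞ (a + b))        ∎)
    where open ≡-Reasoning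

  ⊞-suc : ∀ i k → i ⊞ k ⊞ 1 ≡ i ⊞ suc k
  ⊞-suc i k = trans (⊞-assoc i k 1) (cong (i ⊞_) (ℕ.+-comm k 1))

  ⊞-identityʳ : ∀ i → i ⊞ 0 ≡ i
  ⊞-identityʳ i = toℕ-injective (trans (toℕ-⊞ i 0)
    (trans (cong (_% n) (ℕ.+-identityʳ (toℕ i))) (m<n⇒m%n≡m (toℕ<n i))))

  ⊞-n : ∀ i → i ⊞ n ≡ i
  ⊞-n i = toℕ-injective (trans (toℕ-⊞ i n)
    (trans ([m+n]%n≡m%n (toℕ i) n) (m<n⇒m%n≡m (toℕ<n i))))

  ⊟1-⊞1 : ∀ i → i ⊟ 1 ⊞ 1 ≡ i
  ⊟1-⊞1 i = trans (⊞-assoc i (n ∸ 1) 1) (trans (cong (i ⊞_) (ℕ.m∸n+n≡m 1≤n)) (⊞-n i))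

  ⊞1-⊟1 : ∀ i → i ⊞ 1 ⊟ 1 ≡ i
  ⊞1-⊟1 i = trans (⊞-assoc i 1 (n ∸ 1)) (trans (cong (i ⊞_) (ℕ.m+[n∸m]≡n 1≤n)) (⊞-n i))

  ⊞suc-⊟1 : ∀ i k → i ⊞ suc k ⊟ 1 ≡ i ⊞ k
  ⊞suc-⊟1 i k = trans (cong (_⊟ 1) (sym (⊞-suc i k))) (⊞1-⊟1 (i ⊞ k))

  ⊟1-⊞suc : ∀ i k → i ⊟ 1 ⊞ suc k ≡ i ⊞ k
  ⊟1-⊞suc i k = trans (sym (⊞-assoc (i ⊟ 1) 1 k)) (cong (_⊞ k) (⊟1-⊞1 i))

  ⊞1-injective : ∀ {i j} → i ⊞ 1 ≡ j ⊞ 1 → i ≡ j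
  ⊞1-injective {i} {j} e = trans (sym (⊞1-⊟1 i)) (trans (cong (_⊟ 1) e) (⊞1-⊟1 j))

  -- The representative of a modulo n is read off from i ⊞ a by adding n - toℕ i.
  ⊞-cancel-% : ∀ i {a b} → i ⊞ a ≡ i ⊞ b → a % n ≡ b % n
  ⊞-cancel-% i {a} {b} e =
    trans (sym (unshift a)) (trans (cong (λ j → (toℕ j + (n ∸ t)) % n) e) (unshift b))
    where
      t = toℕ i
      unshift : ∀ c → (toℕ (i ⊞ c) + (n ∸ t)) % n ≡ c % n
      unshift c = begin
        (toℕ (i ⊞ c) + (n ∸ t)) % n     ≡⟨ cong (λ r → (r + (n ∸ t)) % n) (toℕ-⊞ i c) ⟩
        ((t + c) % n + (n ∸ t)) % n     ≡⟨ [m%n+k]%n≡[m+k]%n (t + c) (n ∸ t) ⟩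
        (t + c + (n ∸ t)) % n           ≡⟨ cong (λ r → (r + (n ∸ t)) % n) (ℕ.+-comm t c) ⟩
        (c + t + (n ∸ t)) % n           ≡⟨ cong (_% n) (ℕ.+-assoc c t (n ∸ t)) ⟩
        (c + (t + (n ∸ t))) % n         ≡⟨ cong (λ r → (c + r) % n) (ℕ.m+[n∸m]≡n (ℕ.<⇒≤ (toℕ<n i))) ⟩
        (c + n) % n                     ≡⟨ [m+n]%n≡m%n c n ⟩
        c % n                           ∎
        where open ≡-Reasoning

  ⊞-injectiveʳ : ∀ i {a b} → a < n → b < n → i ⊞ a ≡ i ⊞ b → a ≡ b
  ⊞-injectiveʳ i {a} {b} a<n b<n e =
    trans (sym (m<n⇒m%n≡m a<n)) (trans (⊞-cancel-% i e) (m<n⇒m%n≡m b<n))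

  ≢⊞ : ∀ i {k} → 0 < k → k < n → i ≢ i ⊞ k
  ≢⊞ i {k} 0<k k<n e = ℕ.<⇒≢ 0<k (⊞-injectiveʳ i 1≤n k<n (trans (⊞-identityʳ i) e))

  CycAdj-sym : ∀ {i j} → CycAdj n i j → CycAdj n j i
  CycAdj-sym = swap

  CycAdj? : ∀ i j → Dec (CycAdj n i j)
  CycAdj? i j = (j ≟ i ⊞ 1) ⊎-dec (i ≟ j ⊞ 1)

  CycAdj⇒ : ∀ {j k} → CycAdj n j k → k ≡ j ⊟ 1 ⊎ k ≡ j ⊞ 1
  CycAdj⇒ (inj₁ k≡j⊞1)     = inj₂ k≡j⊞1
  CycAdj⇒ {j} {k} (inj₂ j≡k⊞1) = inj₁ (trans (sym (⊞1-⊟1 k)) (cong (_⊟ 1) (sym j≡k⊞1)))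

  CycAdj-irrefl : 2 ≤ n → ∀ {i} → ¬ CycAdj n i i
  CycAdj-irrefl 2≤n {i} = [ ≢⊞1 , ≢⊞1 ]
    where ≢⊞1 = ≢⊞ i (s≤s z≤n) 2≤n

  ¬CycAdj-avoiding : ∀ {j k} → k ≢ j ⊟ 1 → k ≢ j ⊞ 1 → ¬ CycAdj n j k
  ¬CycAdj-avoiding k≢j⊟1 k≢j⊞1 = [ k≢j⊟1 , k≢j⊞1 ] ∘ CycAdj⇒

  ¬CycAdj-⊟1 : ∀ {i j} → j ≢ i → i ≢ j ⊞ 2 → ¬ CycAdj n j (i ⊟ 1)
  ¬CycAdj-⊟1 {i} {j} j≢i i≢j⊞2 (inj₁ e) =
    i≢j⊞2 (trans (sym (⊟1-⊞1 i)) (trans (cong (_⊞ 1) e) (⊞-assoc j 1 1)))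
  ¬CycAdj-⊟1 {i} {j} j≢i i≢j⊞2 (inj₂ e) = j≢i (trans e (⊟1-⊞1 i))

  ¬CycAdj-⊞1 : ∀ {i j} → j ≢ i → j ≢ i ⊞ 2 → ¬ CycAdj n j (i ⊞ 1)
  ¬CycAdj-⊞1 {i} {j} j≢i j≢i⊞2 (inj₁ e) = j≢i (sym (⊞1-injective e))
  ¬CycAdj-⊞1 {i} {j} j≢i j≢i⊞2 (inj₂ e) = j≢i⊞2 (trans e (⊞-assoc i 1 1))

  Far : Fin n → Fin n → Set
  Far i j = ¬ (i ≡ j ⊎ CycAdj n i j)

  Far-sym : ∀ {i j} → Far i j → Far j i
  Far-sym far = far ∘ Sum.map sym CycAdj-sym

  far-⊞ : ∀ i {k} → 2 ≤ k → 2 + k ≤ n → Far i (i ⊞ k)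
  far-⊞ i {k} 2≤k 2+k≤n (inj₁ e)        = ≢⊞ i (ℕ.m+n≤o⇒n≤o 1 2≤k) (ℕ.m+n≤o⇒n≤o 1 2+k≤n) e
  far-⊞ i {k} 2≤k 2+k≤n (inj₂ (inj₁ e)) =
    ℕ.<⇒≢ 2≤k (sym (⊞-injectiveʳ i (ℕ.m+n≤o⇒n≤o 1 2+k≤n) (ℕ.m+n≤o⇒m≤o 2 2+k≤n) e))
  far-⊞ i {k} 2≤k 2+k≤n (inj₂ (inj₂ e)) = ≢⊞ i (s≤s z≤n) 2+k≤n (trans e (⊞-suc i k))

  far-⊟1 : ∀ i {k} → 1 ≤ k → 3 + k ≤ n → Far (i ⊟ 1) (i ⊞ k)
  far-⊟1 i {k} 1≤k 3+k≤n = subst (Far (i ⊟ 1)) (⊟1-⊞suc i k) (far-⊞ (i ⊟ 1) (s≤s 1≤k) 3+k≤n)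

pattern v i = inj₁ i
pattern v̄ i = inj₂ i

module Prism (n : ℕ) .{{_ : NonZero n}} where

  open Cycle n public

  V : Set
  V = Vertex n

  infix 4 _∈N[_] _∉N[_]

  _∈N[_] : V → V → Set
  w ∈N[ u ] = N[_]∋_ n u w

  _∉N[_] : V → V → Set
  w ∉N[ u ] = ¬ w ∈N[ u ]

  open Separation _∈N[_] public

  _∈N?_ : ∀ w u → Dec (w ∈N[ u ])
  w ∈N? u = ≡-dec _≟_ _≟_ u w ⊎-dec adjacent? u w
    where
      adjacent? : ∀ u w → Dec (Adj n u w)
      adjacent? (v i) (v j) = CycAdj? i j
      adjacent? (v̄ i) (v̄ j) = ¬? (i ≟ j) ×-dec ¬? (CycAdj? i j)
      adjacent? (v i) (v̄ j) = i ≟ j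
      adjacent? (v̄ i) (v j) = i ≟ j

  v∉N[v] : ∀ {i j} → Far i j → v j ∉N[ v i ]
  v∉N[v] far = far ∘ Sum.map₁ inj₁-injective

  v̄∉N[v] : ∀ {i j} → i ≢ j → v̄ j ∉N[ v i ]
  v̄∉N[v] i≢j (inj₂ i≡j) = i≢j i≡j

  v∉N[v̄] : ∀ {i j} → i ≢ j → v j ∉N[ v̄ i ]
  v∉N[v̄] i≢j (inj₂ i≡j) = i≢j i≡j

  v̄∈N[v̄] : ∀ {i j} → ¬ CycAdj n i j → v̄ j ∈N[ v̄ i ]
  v̄∈N[v̄] {i} {j} ¬adj with i ≟ j
  ... | yes refl = inj₁ refl
  ... | no  i≢j  = inj₂ (i≢j , ¬adj)

  v̄∉N[v̄] : 2 ≤ n → ∀ {i j} → CycAdj n i j → v̄ j ∉N[ v̄ i ]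
  v̄∉N[v̄] 2≤n adj (inj₁ refl)      = CycAdj-irrefl 2≤n adj
  v̄∉N[v̄] 2≤n adj (inj₂ (_ , ¬adj)) = ¬adj adj

  v̄-cover : ∀ i j {w} → w ∈N[ v̄ i ] → w ∈N[ v̄ j ] ⊎ w ∈ₗ (v i ∷ v̄ (j ⊟ 1) ∷ v̄ (j ⊞ 1) ∷ [])
  v̄-cover i j {v k}  (inj₂ refl) = inj₂ (here refl)
  v̄-cover i j {v̄ k}  _ with CycAdj? j k
  ... | no  ¬adj = inj₁ (v̄∈N[v̄] ¬adj)
  ... | yes adj  = inj₂ (there ([ here ∘ cong v̄ , there ∘ here ∘ cong v̄ ] (CycAdj⇒ adj)))

  -- Vertex lists in the order of the sums in C(i), C(i,i+1), C(i,i+2), C̄(i,j), C̄(i,i+2).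
  nbhd : Fin n → List V
  nbhd i = v (i ⊟ 1) ∷ v i ∷ v̄ i ∷ v (i ⊞ 1) ∷ []

  nbhd-complete : ∀ i {w} → w ∈N[ v i ] → w ∈ₗ nbhd i
  nbhd-complete i        (inj₁ refl)             = there (here refl)
  nbhd-complete i {v k}  (inj₂ (inj₁ refl))      = there (there (there (here refl)))
  nbhd-complete ._ {v k} (inj₂ (inj₂ refl))      = here (cong v (sym (⊞1-⊟1 k)))
  nbhd-complete i {v̄ k}  (inj₂ refl)             = there (there (here refl))

  v⊟1∈N[v] : ∀ i → v (i ⊟ 1) ∈N[ v i ]
  v⊟1∈N[v] i = inj₂ (inj₂ (sym (⊟1-⊞1 i)))

  nbhd-sound : ∀ i → All (_∈N[ v i ]) (nbhd i)
  nbhd-sound i = v⊟1∈N[v] i ∷ inj₁ refl ∷ inj₂ refl ∷ inj₂ (inj₁ refl) ∷ []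

  nbhd-distinguishes : ∀ {i j} → j ≢ i → j ≢ i ⊞ 1 → i ≢ j ⊞ 1 → j ≢ i ⊞ 2 → i ≢ j ⊞ 2 →
    All (λ w → Distinguishes w (v i) (v j)) (nbhd i)
  nbhd-distinguishes {i} {j} j≢i j≢i⊞1 i≢j⊞1 j≢i⊞2 i≢j⊞2 =
      inj₁ (v⊟1∈N[v] i , v∉N[v] [ j≢i⊟1 , ¬CycAdj-⊟1 j≢i i≢j⊞2 ])
    ∷ inj₁ (inj₁ refl , v∉N[v] [ j≢i , [ i≢j⊞1 , j≢i⊞1 ] ])
    ∷ inj₁ (inj₂ refl , v̄∉N[v] j≢i)
    ∷ inj₁ (inj₂ (inj₁ refl) , v∉N[v] [ j≢i⊞1 , ¬CycAdj-⊞1 j≢i j≢i⊞2 ])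
    ∷ []
    where
      j≢i⊟1 : j ≢ i ⊟ 1
      j≢i⊟1 e = i≢j⊞1 (trans (sym (⊟1-⊞1 i)) (cong (_⊞ 1) (sym e)))

  △-vv⁺ : Fin n → List V
  △-vv⁺ i = v (i ⊟ 1) ∷ v̄ i ∷ v̄ (i ⊞ 1) ∷ v (i ⊞ 2) ∷ []

  △-vv⁺-complete : ∀ i {w} → Distinguishes w (v i) (v (i ⊞ 1)) → w ∈ₗ △-vv⁺ i
  △-vv⁺-complete i = distinguishers-within
    (λ w∈ → All.lookup cover (nbhd-complete i w∈))
    (λ w∈ → All.lookup cover′ (nbhd-complete (i ⊞ 1) w∈))
    where
      cover : All (λ w → w ∈N[ v (i ⊞ 1) ] ⊎ w ∈ₗ △-vv⁺ i) (nbhd i)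
      cover = inj₂ (here refl) ∷ inj₁ (inj₂ (inj₂ refl)) ∷ inj₂ (there (here refl))
            ∷ inj₁ (inj₁ refl) ∷ []
      cover′ : All (λ w → w ∈N[ v i ] ⊎ w ∈ₗ △-vv⁺ i) (nbhd (i ⊞ 1))
      cover′ = inj₁ (inj₁ (cong v (sym (⊞1-⊟1 i)))) ∷ inj₁ (inj₂ (inj₁ refl))
             ∷ inj₂ (there (there (here refl)))
             ∷ inj₂ (there (there (there (here (cong v (⊞-assoc i 1 1)))))) ∷ []

  △-vv⁺-sound : 4 ≤ n → ∀ i → All (λ w → Distinguishes w (v i) (v (i ⊞ 1))) (△-vv⁺ i)
  △-vv⁺-sound 4≤n i =
      inj₁ (v⊟1∈N[v] i , v∉N[v] (Far-sym (far-⊟1 i {1} ℕ.≤-refl 4≤n)))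
    ∷ inj₁ (inj₂ refl , v̄∉N[v] (i≢i⊞1 ∘ sym))
    ∷ inj₂ (inj₂ refl , v̄∉N[v] i≢i⊞1)
    ∷ inj₂ (inj₂ (inj₁ (sym (⊞-assoc i 1 1))) , v∉N[v] (far-⊞ i {2} ℕ.≤-refl 4≤n))
    ∷ []
    where
      i≢i⊞1 : i ≢ i ⊞ 1
      i≢i⊞1 = ≢⊞ i (s≤s z≤n) (ℕ.m+n≤o⇒n≤o 2 4≤n)

  △-vv⁺⁺ : Fin n → List V
  △-vv⁺⁺ i = v (i ⊟ 1) ∷ v i ∷ v̄ i ∷ v (i ⊞ 2) ∷ v̄ (i ⊞ 2) ∷ v (i ⊞ 3) ∷ []

  △-vv⁺⁺-complete : ∀ i {w} → Distinguishes w (v i) (v (i ⊞ 2)) → w ∈ₗ △-vv⁺⁺ i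
  △-vv⁺⁺-complete i = distinguishers-within
    (λ w∈ → All.lookup cover (nbhd-complete i w∈))
    (λ w∈ → All.lookup cover′ (nbhd-complete (i ⊞ 2) w∈))
    where
      cover : All (λ w → w ∈N[ v (i ⊞ 2) ] ⊎ w ∈ₗ △-vv⁺⁺ i) (nbhd i)
      cover = inj₂ (here refl) ∷ inj₂ (there (here refl)) ∷ inj₂ (there (there (here refl)))
            ∷ inj₁ (inj₂ (inj₂ (sym (⊞-assoc i 1 1)))) ∷ []
      cover′ : All (λ w → w ∈N[ v i ] ⊎ w ∈ₗ △-vv⁺⁺ i) (nbhd (i ⊞ 2))
      cover′ = inj₁ (inj₂ (inj₁ (⊞suc-⊟1 i 1)))
             ∷ inj₂ (there (there (there (here refl))))
             ∷ inj₂ (there (there (there (there (here refl)))))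
             ∷ inj₂ (there (there (there (there (there (here (cong v (⊞-assoc i 2 1))))))))
             ∷ []

  △-vv⁺⁺-sound : 5 ≤ n → ∀ i → All (λ w → Distinguishes w (v i) (v (i ⊞ 2))) (△-vv⁺⁺ i)
  △-vv⁺⁺-sound 5≤n i =
      inj₁ (v⊟1∈N[v] i , v∉N[v] (Far-sym (far-⊟1 i {2} (s≤s z≤n) 5≤n)))
    ∷ inj₁ (inj₁ refl , v∉N[v] (Far-sym far₂))
    ∷ inj₁ (inj₂ refl , v̄∉N[v] (far₂ ∘ inj₁ ∘ sym))
    ∷ inj₂ (inj₁ refl , v∉N[v] far₂)
    ∷ inj₂ (inj₂ refl , v̄∉N[v] (far₂ ∘ inj₁))
    ∷ inj₂ (inj₂ (inj₁ (sym (⊞-assoc i 2 1))) , v∉N[v] (far-⊞ i {3} (s≤s (s≤s z≤n)) 5≤n))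
    ∷ []
    where
      far₂ : Far i (i ⊞ 2)
      far₂ = far-⊞ i ℕ.≤-refl (ℕ.m+n≤o⇒n≤o 1 5≤n)

  △-v̄v̄ : Fin n → Fin n → List V
  △-v̄v̄ i j = v̄ (i ⊟ 1) ∷ v i ∷ v̄ (i ⊞ 1) ∷ v̄ (j ⊟ 1) ∷ v j ∷ v̄ (j ⊞ 1) ∷ []

  △-v̄v̄-complete : ∀ i j {w} → Distinguishes w (v̄ i) (v̄ j) → w ∈ₗ △-v̄v̄ i j
  △-v̄v̄-complete i j = distinguishers-within
    (Sum.map₂ embed ∘ v̄-cover i j) (Sum.map₂ embed′ ∘ v̄-cover j i)
    where
      embed : ∀ {w} → w ∈ₗ (v i ∷ v̄ (j ⊟ 1) ∷ v̄ (j ⊞ 1) ∷ []) → w ∈ₗ △-v̄v̄ i j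
      embed (here e)                   = there (here e)
      embed (there (here e))           = there (there (there (here e)))
      embed (there (there (here e)))   = there (there (there (there (there (here e)))))
      embed (there (there (there ())))
      embed′ : ∀ {w} → w ∈ₗ (v j ∷ v̄ (i ⊟ 1) ∷ v̄ (i ⊞ 1) ∷ []) → w ∈ₗ △-v̄v̄ i j
      embed′ (here e)                  = there (there (there (there (here e))))
      embed′ (there (here e))          = here e
      embed′ (there (there (here e)))  = there (there (here e))
      embed′ (there (there (there ())))

  △-v̄v̄-sound : 2 ≤ n → ∀ {i j} → j ≢ i → j ≢ i ⊞ 2 → i ≢ j ⊞ 2 →
    All (λ w → Distinguishes w (v̄ i) (v̄ j)) (△-v̄v̄ i j)
  △-v̄v̄-sound 2≤n j≢i j≢i⊞2 i≢j⊞2 =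
    ++⁺ (half j≢i j≢i⊞2 i≢j⊞2) (All.map Distinguishes-sym (half (j≢i ∘ sym) i≢j⊞2 j≢i⊞2))
    where
      half : ∀ {i j} → j ≢ i → j ≢ i ⊞ 2 → i ≢ j ⊞ 2 →
        All (λ w → Distinguishes w (v̄ i) (v̄ j)) (v̄ (i ⊟ 1) ∷ v i ∷ v̄ (i ⊞ 1) ∷ [])
      half {i} j≢i j≢i⊞2 i≢j⊞2 =
          inj₂ (v̄∈N[v̄] (¬CycAdj-⊟1 j≢i i≢j⊞2) , v̄∉N[v̄] 2≤n (inj₂ (sym (⊟1-⊞1 i))))
        ∷ inj₁ (inj₂ refl , v∉N[v̄] j≢i)
        ∷ inj₂ (v̄∈N[v̄] (¬CycAdj-⊞1 j≢i j≢i⊞2) , v̄∉N[v̄] 2≤n (inj₁ refl))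
        ∷ []

  △-v̄v̄⁺⁺ : Fin n → List V
  △-v̄v̄⁺⁺ i = v̄ (i ⊟ 1) ∷ v i ∷ v (i ⊞ 2) ∷ v̄ (i ⊞ 3) ∷ []

  △-v̄v̄⁺⁺-complete : 2 ≤ n → ∀ i {w} → Distinguishes w (v̄ i) (v̄ (i ⊞ 2)) → w ∈ₗ △-v̄v̄⁺⁺ i
  △-v̄v̄⁺⁺-complete 2≤n i = distinguishers-within cover cover′
    where
      cover : ∀ {w} → w ∈N[ v̄ i ] → w ∈N[ v̄ (i ⊞ 2) ] ⊎ w ∈ₗ △-v̄v̄⁺⁺ i
      cover w∈ with v̄-cover i (i ⊞ 2) w∈
      ... | inj₁ w∈′                      = inj₁ w∈′
      ... | inj₂ (here e)                 = inj₂ (there (here e))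
      ... | inj₂ (there (here refl))      = ⊥-elim (v̄∉N[v̄] 2≤n (inj₁ (⊞suc-⊟1 i 1)) w∈)
      ... | inj₂ (there (there (here e))) =
        inj₂ (there (there (there (here (trans e (cong v̄ (⊞-assoc i 2 1)))))))
      cover′ : ∀ {w} → w ∈N[ v̄ (i ⊞ 2) ] → w ∈N[ v̄ i ] ⊎ w ∈ₗ △-v̄v̄⁺⁺ i
      cover′ w∈ with v̄-cover (i ⊞ 2) i w∈
      ... | inj₁ w∈′                        = inj₁ w∈′
      ... | inj₂ (here e)                   = inj₂ (there (there (here e)))
      ... | inj₂ (there (here e))           = inj₂ (here e)
      ... | inj₂ (there (there (here refl))) =
        ⊥-elim (v̄∉N[v̄] 2≤n (inj₂ (sym (⊞-assoc i 1 1))) w∈)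

  △-v̄v̄⁺⁺-sound : 5 ≤ n → ∀ i → All (λ w → Distinguishes w (v̄ i) (v̄ (i ⊞ 2))) (△-v̄v̄⁺⁺ i)
  △-v̄v̄⁺⁺-sound 5≤n i =
      inj₂ (v̄∈N[v̄] (Far-sym (far-⊟1 i {2} (s≤s z≤n) 5≤n) ∘ inj₂)
          , v̄∉N[v̄] 2≤n (inj₂ (sym (⊟1-⊞1 i))))
    ∷ inj₁ (inj₂ refl , v∉N[v̄] (far₂ ∘ inj₁ ∘ sym))
    ∷ inj₂ (inj₂ refl , v∉N[v̄] (far₂ ∘ inj₁))
    ∷ inj₁ (v̄∈N[v̄] (far-⊞ i {3} (s≤s (s≤s z≤n)) 5≤n ∘ inj₂)
          , v̄∉N[v̄] 2≤n (inj₁ (sym (⊞-assoc i 2 1))))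
    ∷ []
    where
      2≤n : 2 ≤ n
      2≤n = ℕ.m+n≤o⇒n≤o 3 5≤n
      far₂ : Far i (i ⊞ 2)
      far₂ = far-⊞ i ℕ.≤-refl (ℕ.m+n≤o⇒n≤o 1 5≤n)

module Code (n : ℕ) .{{_ : NonZero n}} (C Cb : Subset n) where

  open Prism n

  D : V → Set
  D = InCode n C Cb

  D? : ∀ w → Dec (D w)
  D? (v i)  = i ∈? C
  D? (v̄ i) = i ∈? Cb

  x-positive⇔∈ : ∀ S i → 1 ≤ x n S i ⇔ i ∈ S
  x-positive⇔∈ S i with lookup S i in eq
  ... | true  = mk⇔ (λ _ → lookup⇒[]= i S eq) (λ _ → s≤s z≤n)
  ... | false = mk⇔ (λ ()) (λ i∈S → case trans (sym ([]=⇒lookup i∈S)) eq of λ ())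

  indicator : V → ℕ
  indicator (v i)  = x n C i
  indicator (v̄ i) = x n Cb i

  indicator-positive⇔ : ∀ w → 1 ≤ indicator w ⇔ D w
  indicator-positive⇔ (v i)  = x-positive⇔∈ C i
  indicator-positive⇔ (v̄ i) = x-positive⇔∈ Cb i

  -- A left fold, so that the weight of a list unfolds to the left-nested sums of Conditions.
  weight : List V → ℕ
  weight = foldl (λ s w → s + indicator w) 0

  weight-positive⇒ : ∀ S → 1 ≤ weight S → Any D S
  weight-positive⇒ S p with to (1≤foldl-+⇔ indicator 0 S) p
  ... | inj₂ positive = Any.map (λ {w} → to (indicator-positive⇔ w)) positive

  weight-positive⇐ : ∀ S → Any D S → 1 ≤ weight S
  weight-positive⇐ S =
    from (1≤foldl-+⇔ indicator 0 S) ∘ inj₂ ∘ Any.map (λ {w} → from (indicator-positive⇔ w))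

  condition-necessary : IsIdentifyingCode n C Cb → ∀ {u u′ S} → u ≢ u′ →
    (∀ {w} → Distinguishes w u u′ → w ∈ₗ S) → 1 ≤ weight S
  condition-necessary (_ , separating) u≢u′ complete =
    weight-positive⇐ _ (some-distinguisher-in D _∈N?_ D? complete (separating _ _ u≢u′))

  condition-sufficient : ∀ {u u′ S} → All (λ w → Distinguishes w u u′) S → 1 ≤ weight S →
    ¬ Indistinguishable D u u′
  condition-sufficient dists = distinguished-by-any D dists ∘ weight-positive⇒ _

  identifying⇒conditions : 3 ≤ n → IsIdentifyingCode n C Cb → Conditions n C Cb
  identifying⇒conditions 3≤n code@(dominating , _) =
      (λ i → weight-positive⇐ _ (dominator-in D (nbhd-complete i) (dominating (v i))))
    , (λ i → condition-necessary code (i≢i⊞1 i ∘ inj₁-injective) (△-vv⁺-complete i))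
    , (λ i → condition-necessary code (i≢i⊞2 i ∘ inj₁-injective) (△-vv⁺⁺-complete i))
    , (λ i j j≢i _ → condition-necessary code (j≢i ∘ sym ∘ inj₂-injective) (△-v̄v̄-complete i j))
    , (λ i → condition-necessary code (i≢i⊞2 i ∘ inj₂-injective) (△-v̄v̄⁺⁺-complete 2≤n i))
    where
      2≤n : 2 ≤ n
      2≤n = ℕ.m+n≤o⇒n≤o 1 3≤n
      i≢i⊞1 : ∀ i → i ≢ i ⊞ 1
      i≢i⊞1 i = ≢⊞ i (s≤s z≤n) 2≤n
      i≢i⊞2 : ∀ i → i ≢ i ⊞ 2
      i≢i⊞2 i = ≢⊞ i (s≤s z≤n) 3≤n

  v̄-dominated : 3 ≤ ∣ Cb ∣ → ∀ i → ∃ λ w → D w × w ∈N[ v̄ i ]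
  v̄-dominated 3≤∣Cb∣ i with ∃-∈-avoiding (i ⊟ 1 ∷ i ⊞ 1 ∷ []) 3≤∣Cb∣
  ... | k , k∈Cb , k≢i⊟1 ∷ k≢i⊞1 ∷ [] = v̄ k , k∈Cb , v̄∈N[v̄] (¬CycAdj-avoiding k≢i⊟1 k≢i⊞1)

  v-v̄-separated : 4 ≤ ∣ Cb ∣ → ∀ i j → ¬ Indistinguishable D (v i) (v̄ j)
  v-v̄-separated 4≤∣Cb∣ i j with ∃-∈-avoiding (j ⊟ 1 ∷ j ⊞ 1 ∷ i ∷ []) 4≤∣Cb∣
  ... | k , k∈Cb , k≢j⊟1 ∷ k≢j⊞1 ∷ k≢i ∷ [] =
    distinguished D {v̄ k} k∈Cb
      (inj₂ (v̄∈N[v̄] (¬CycAdj-avoiding k≢j⊟1 k≢j⊞1) , v̄∉N[v] (k≢i ∘ sym)))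

  v-v-separated : 5 ≤ n →
    (∀ i → 1 ≤ weight (nbhd i)) → (∀ i → 1 ≤ weight (△-vv⁺ i)) → (∀ i → 1 ≤ weight (△-vv⁺⁺ i)) →
    ∀ {i j} → i ≢ j → ¬ Indistinguishable D (v i) (v j)
  v-v-separated 5≤n cᵢ cᵢᵢ₊₁ cᵢᵢ₊₂ {i} {j} i≢j with j ≟ i ⊞ 1 | i ≟ j ⊞ 1 | j ≟ i ⊞ 2 | i ≟ j ⊞ 2
  ... | yes refl | _        | _        | _        =
    condition-sufficient (△-vv⁺-sound (ℕ.m+n≤o⇒n≤o 1 5≤n) i) (cᵢᵢ₊₁ i)
  ... | no _     | yes refl | _        | _        =
    condition-sufficient (△-vv⁺-sound (ℕ.m+n≤o⇒n≤o 1 5≤n) j) (cᵢᵢ₊₁ j) ∘ Indistinguishable-sym D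
  ... | no _     | no _     | yes refl | _        =
    condition-sufficient (△-vv⁺⁺-sound 5≤n i) (cᵢᵢ₊₂ i)
  ... | no _     | no _     | no _     | yes refl =
    condition-sufficient (△-vv⁺⁺-sound 5≤n j) (cᵢᵢ₊₂ j) ∘ Indistinguishable-sym D
  ... | no j≢i⊞1 | no i≢j⊞1 | no j≢i⊞2 | no i≢j⊞2 =
    condition-sufficient (nbhd-distinguishes (i≢j ∘ sym) j≢i⊞1 i≢j⊞1 j≢i⊞2 i≢j⊞2) (cᵢ i)

  v̄-v̄-separated : 5 ≤ n →
    (∀ i j → j ≢ i → j ≢ i ⊞ 2 → 1 ≤ weight (△-v̄v̄ i j)) → (∀ i → 1 ≤ weight (△-v̄v̄⁺⁺ i)) →
    ∀ {i j} → i ≢ j → ¬ Indistinguishable D (v̄ i) (v̄ j)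
  v̄-v̄-separated 5≤n c̄ᵢⱼ c̄ᵢᵢ₊₂ {i} {j} i≢j with j ≟ i ⊞ 2 | i ≟ j ⊞ 2
  ... | yes refl | _        = condition-sufficient (△-v̄v̄⁺⁺-sound 5≤n i) (c̄ᵢᵢ₊₂ i)
  ... | no _     | yes refl =
    condition-sufficient (△-v̄v̄⁺⁺-sound 5≤n j) (c̄ᵢᵢ₊₂ j) ∘ Indistinguishable-sym D
  ... | no j≢i⊞2 | no i≢j⊞2 =
    condition-sufficient (△-v̄v̄-sound (ℕ.m+n≤o⇒n≤o 3 5≤n) (i≢j ∘ sym) j≢i⊞2 i≢j⊞2)
                         (c̄ᵢⱼ i j (i≢j ∘ sym) j≢i⊞2)

  conditions⇒identifying : 5 ≤ n → 4 ≤ ∣ Cb ∣ → Conditions n C Cb → IsIdentifyingCode n C Cb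
  conditions⇒identifying 5≤n 4≤∣Cb∣ (cᵢ , cᵢᵢ₊₁ , cᵢᵢ₊₂ , c̄ᵢⱼ , c̄ᵢᵢ₊₂) = dominating , separating
    where
      dominating : ∀ u → ∃ λ w → D w × w ∈N[ u ]
      dominating (v i)  = dominated-by-any D (nbhd-sound i) (weight-positive⇒ _ (cᵢ i))
      dominating (v̄ i) = v̄-dominated (ℕ.<⇒≤ 4≤∣Cb∣) i
      separating : ∀ u u′ → u ≢ u′ → ¬ Indistinguishable D u u′
      separating (v i)  (v j)  u≢u′ = v-v-separated 5≤n cᵢ cᵢᵢ₊₁ cᵢᵢ₊₂ (u≢u′ ∘ cong v)
      separating (v i)  (v̄ j) _    = v-v̄-separated 4≤∣Cb∣ i j
      separating (v̄ i) (v j)  _    = v-v̄-separated 4≤∣Cb∣ j i ∘ Indistinguishable-sym D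
      separating (v̄ i) (v̄ j) u≢u′ = v̄-v̄-separated 5≤n c̄ᵢⱼ c̄ᵢᵢ₊₂ (u≢u′ ∘ cong v̄)

lemma1 : (n : ℕ) .{{_ : NonZero n}} → 9 ≤ n → (C Cb : Subset n) →
    (IsIdentifyingCode n C Cb → Conditions n C Cb)
    × (4 ≤ ∣ Cb ∣ → (IsIdentifyingCode n C Cb ⇔ Conditions n C Cb))
lemma1 n 9≤n C Cb = necessary , λ 4≤∣Cb∣ → mk⇔ necessary (conditions⇒identifying 5≤n 4≤∣Cb∣)
  where
    open Code n C Cb
    5≤n : 5 ≤ n
    5≤n = ℕ.m+n≤o⇒n≤o 4 9≤n
    necessary : IsIdentifyingCode n C Cb → Conditions n C Cb
    necessary = identifying⇒conditions (ℕ.m+n≤o⇒n≤o 2 5≤n)
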